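{- Fix $d\geq k\geq 1$. In $\alpha_{d,k}^-$-trees of charge $k$ and in $\alpha_{d,k}^+$-trees of charge $-k$, all opening stems are incident to black vertices and all closing stems are incident to white vertices.
   Context: A blossoming tree is a plane tree rooted at a corner (root vertex $\rho$) whose vertices may carry opening stems (outgoing dangling half-edges) and closing stems (ingoing), counted in degrees; charge = #closing − #opening stems. A $(d+1)$-fractional orientation assigns values in $\mathbb{Z}_{\ge0}$ to half-edges with the two halves of each edge summing to $d+1$, value $0$ on closing stems and $d+1$ on opening stems; outdegree = sum over incident half-edges; accessible = every vertex has a path of forward edges ($(h_1,h_2)$ with $\mathcal{O}(h_1)>0$) to $\rho$. With $\alpha_d(v)=d\deg(v)$ for black and $\deg(v)$ for white $v$, set $\alpha_{d,k}^-(v)=\alpha_d(v)-k\mathbf{1}_{\{v=\rho\}}$ and $\alpha_{d,k}^+(v)=\alpha_d(v)+k\mathbf{1}_{\{v=\rho\}}$. An $\alpha_{d,k}^-$-tree (resp. $\alpha_{d,k}^+$-tree) is a properly black/white colored blossoming tree with all degrees at most $d$, equipped with an accessible $(d+1)$-fractional orientation with outdegrees $\alpha_{d,k}^-$ (resp. $\alpha_{d,k}^+$). The trivial trees consisting of a single black vertex with one closing stem, or a single white vertex with one opening stem, are excluded from these classes. -}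

module Defs where

open import Data.Nat using (ℕ; zero; suc; _+_; _*_; _∸_; _≤_; _<_)
open import Data.Integer using (ℤ; +_) renaming (_-_ to _⊖ᶻ_)
open import Data.List using (List; []; _∷_; length; _++_)
open import Data.List.Membership.Propositional using (_∈_)
open import Data.Maybe using (Maybe; just; nothing)
open import Data.Product using (_×_; _,_)
open import Data.Sum using (_⊎_)
open import Data.Unit using (⊤)
open import Relation.Nullary using (¬_)
open import Relation.Binary.PropositionalEquality using (_≡_)
open import Relation.Binary.Construct.Closure.ReflexiveTransitive using (Star)

data Colour : Set where
  black white : Colour

flipC : Colour → Colour
flipC black = white
flipC white = black

-- A plane tree rooted at a corner is an ordered rooted tree: each vertex
-- has the list of its incident half-edges other than the edge to its
-- parent, in clockwise order starting from the root corner (for the root)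
-- resp. after the parent edge (for other vertices).
-- An edge item  edge a s  records the orientation value  a  of the
-- half-edge on the parent side; the child-side half-edge then has value
-- (d+1) - a.

data Tree : Set
data Item : Set

data Item where
  opening : Item
  closing : Item
  edge    : ℕ → Tree → Item

data Tree where
  node : List Item → Tree

itemOut : ℕ → Item → ℕ
itemOut d opening    = suc d
itemOut d closing    = 0
itemOut d (edge a _) = a

outSum : ℕ → List Item → ℕ
outSum d []       = 0
outSum d (x ∷ xs) = itemOut d x + outSum d xs

α : ℕ → Colour → ℕ → ℕ
α d black deg = d * deg
α d white deg = deg

-- Local conditions at non-root vertices: colour c, parent-side value p
-- of the edge to the parent; degree at most d, half-edge values in
-- {0..d+1}, outdegree = α_d.
mutual
  ValidSub : ℕ → Colour → ℕ → Tree → Set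
  ValidSub d c p (node is) =
    (suc (length is) ≤ d) ×
    (outSum d is + (suc d ∸ p) ≡ α d c (suc (length is))) ×
    ValidItems d c is

  ValidItems : ℕ → Colour → List Item → Set
  ValidItems d c []             = ⊤
  ValidItems d c (opening ∷ is) = ValidItems d c is
  ValidItems d c (closing ∷ is) = ValidItems d c is
  ValidItems d c (edge a s ∷ is) =
    (a ≤ suc d) × ValidSub d (flipC c) a s × ValidItems d c is

ValidRootMinus : ℕ → ℕ → Colour → Tree → Set
ValidRootMinus d k c (node is) =
  (length is ≤ d) × (outSum d is + k ≡ α d c (length is)) × ValidItems d c is

ValidRootPlus : ℕ → ℕ → Colour → Tree → Set
ValidRootPlus d k c (node is) =
  (length is ≤ d) × (outSum d is ≡ α d c (length is) + k) × ValidItems d c is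

mutual
  nOpen : Tree → ℕ
  nOpen (node is) = nOpenI is

  nOpenI : List Item → ℕ
  nOpenI []              = 0
  nOpenI (opening ∷ is)  = suc (nOpenI is)
  nOpenI (closing ∷ is)  = nOpenI is
  nOpenI (edge _ s ∷ is) = nOpen s + nOpenI is

mutual
  nClose : Tree → ℕ
  nClose (node is) = nCloseI is

  nCloseI : List Item → ℕ
  nCloseI []              = 0
  nCloseI (opening ∷ is)  = nCloseI is
  nCloseI (closing ∷ is)  = suc (nCloseI is)
  nCloseI (edge _ s ∷ is) = nClose s + nCloseI is

charge : Tree → ℤ
charge t = (+ nClose t) ⊖ᶻ (+ nOpen t)

-- Vertices are addressed by root-first lists of item indices.

nth : {A : Set} → List A → ℕ → Maybe A
nth []       _       = nothing
nth (x ∷ xs) zero    = just x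
nth (x ∷ xs) (suc i) = nth xs i

sub : Tree → List ℕ → Maybe Tree
sub t [] = just t
sub (node is) (i ∷ u) with nth is i
... | just (edge _ s) = sub s u
... | _               = nothing

colourAt : Colour → List ℕ → Colour
colourAt c []      = c
colourAt c (_ ∷ u) = colourAt (flipC c) u

-- Forward edges (h₁,h₂) with O(h₁) > 0, from the vertex of h₁ to that of h₂.
data Fwd (d : ℕ) (t : Tree) : List ℕ → List ℕ → Set where
  down : ∀ {u is i a s} → sub t u ≡ just (node is) → nth is i ≡ just (edge a s) →
         0 < a → Fwd d t u (u ++ i ∷ [])
  up   : ∀ {u is i a s} → sub t u ≡ just (node is) → nth is i ≡ just (edge a s) →
         0 < suc d ∸ a → Fwd d t (u ++ i ∷ []) u

Accessible : ℕ → Tree → Set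
Accessible d t = ∀ u s → sub t u ≡ just s → Star (Fwd d t) u []

Trivial : Colour → Tree → Set
Trivial c t = (c ≡ black × t ≡ node (closing ∷ [])) ⊎ (c ≡ white × t ≡ node (opening ∷ []))

IsAlphaMinusTree : ℕ → ℕ → Colour → Tree → Set
IsAlphaMinusTree d k c t = ValidRootMinus d k c t × Accessible d t × ¬ Trivial c t

IsAlphaPlusTree : ℕ → ℕ → Colour → Tree → Set
IsAlphaPlusTree d k c t = ValidRootPlus d k c t × Accessible d t × ¬ Trivial c t

StemsWellPlaced : Colour → Tree → Set
StemsWellPlaced c t = ∀ u is → sub t u ≡ just (node is) →
  (opening ∈ is → colourAt c u ≡ black) × (closing ∈ is → colourAt c u ≡ white)

-- Every half-edge value is at most d + 1, and a vertex has degree at most d.  At a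
-- black vertex each closing stem wastes a slot of capacity d + 1, at a white vertex
-- each opening stem alone carries d + 1; comparing with the prescribed outdegree
-- (d·deg resp. deg) rules out such stems at every non-root vertex, at a white root
-- of an α⁻-tree and at a black root of an α⁺-tree.  For the other two roots we
-- count charge: summing outdegrees shows that a subtree with black (white) root whose
-- parent edge has value p on the parent side has charge 1 − p (d − p), so the
-- prescribed total charge forces (d − 1)·#misplaced root stems = 0.  When d = 1 the
-- root has degree 1, and a misplaced stem would make the tree one of the excluded
-- trivial trees.
module Submission where

open import Defs
open import Data.Nat using (ℕ; zero; suc; _+_; _*_; _∸_; _≤_; s≤s; z≤n)
open import Data.Nat.Properties
open import Data.Nat.Tactic.RingSolver using (solve)
open import Algebra.Properties.CommutativeSemigroup +-commutativeSemigroup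
  using (interchange; x∙yz≈y∙xz; x∙yz≈zx∙y; x∙yz≈xz∙y)
open import Data.Integer using (ℤ; +_; -_) renaming (_+_ to _+ᶻ_; _-_ to _-ᶻ_)
import Data.Integer.Properties as ℤ
import Data.Integer.Tactic.RingSolver as ℤ-Solver
open import Data.List using (List; []; _∷_; length)
open import Data.List.Membership.Propositional using (_∈_)
open import Data.List.Relation.Unary.Any using (there)
open import Data.Maybe using (just)
open import Data.Product using (_×_; _,_; proj₂)
open import Data.Sum using (_⊎_; inj₁; inj₂; [_,_]′)
open import Data.Empty using (⊥-elim)
open import Function using (id; _∘_)
open import Relation.Nullary using (¬_)
open import Relation.Binary.PropositionalEquality
  using (_≡_; refl; sym; trans; cong; cong₂; subst; module ≡-Reasoning)

m*[1+n]≤n⇒m≡0 : ∀ {m n} → m * suc n ≤ n → m ≡ 0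
m*[1+n]≤n⇒m≡0 {zero}      _ = refl
m*[1+n]≤n⇒m≡0 {suc _} {n} h = ⊥-elim (n≮n n (m+n≤o⇒m≤o (suc n) h))

m*n≡n⇒n≡0⊎m≡1 : ∀ m n → m * n ≡ n → n ≡ 0 ⊎ m ≡ 1
m*n≡n⇒n≡0⊎m≡1 m zero      _  = inj₁ refl
m*n≡n⇒n≡0⊎m≡1 m n@(suc _) eq = inj₂ (*-cancelʳ-≡ m 1 n (trans eq (sym (*-identityˡ n))))

emptySlots-bound : ∀ {d l o} c e → d * l ≤ e + o → o + c * suc d ≤ l * suc d → c * suc d ≤ e + l
emptySlots-bound {d} {l} {o} c e dl≤ slots = +-cancelʳ-≤ (d * l) (c * suc d) (e + l) (begin
  c * suc d + d * l   ≤⟨ +-monoʳ-≤ (c * suc d) dl≤ ⟩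
  c * suc d + (e + o) ≡⟨ solve (c ∷ d ∷ e ∷ o ∷ []) ⟩
  o + c * suc d + e   ≤⟨ +-monoˡ-≤ e slots ⟩
  l * suc d + e       ≡⟨ solve (l ∷ d ∷ e ∷ []) ⟩
  e + l + d * l       ∎)
  where open ≤-Reasoning

misplacedStems : Colour → List Item → ℕ
misplacedStems c     []               = 0
misplacedStems c     (edge _ _ ∷ is)  = misplacedStems c is
misplacedStems black (opening ∷ is)   = misplacedStems black is
misplacedStems black (closing ∷ is)   = suc (misplacedStems black is)
misplacedStems white (opening ∷ is)   = suc (misplacedStems white is)
misplacedStems white (closing ∷ is)   = misplacedStems white is

outSum-lowerBound : ∀ d is → misplacedStems white is * suc d ≤ outSum d is
outSum-lowerBound d []             = z≤n
outSum-lowerBound d (opening ∷ is) = +-monoʳ-≤ (suc d) (outSum-lowerBound d is)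
outSum-lowerBound d (closing ∷ is) = outSum-lowerBound d is
outSum-lowerBound d (edge a _ ∷ is) =
  ≤-trans (outSum-lowerBound d is) (m≤n+m (outSum d is) a)

outSum-upperBound : ∀ {d c} is → ValidItems d c is →
  outSum d is + misplacedStems black is * suc d ≤ length is * suc d
outSum-upperBound [] _ = z≤n
outSum-upperBound {d} (opening ∷ is) v =
  ≤-trans (≤-reflexive (+-assoc (suc d) _ _))
          (+-monoʳ-≤ (suc d) (outSum-upperBound is v))
outSum-upperBound {d} (closing ∷ is) v =
  ≤-trans (≤-reflexive (x∙yz≈y∙xz (outSum d is) (suc d) _))
          (+-monoʳ-≤ (suc d) (outSum-upperBound is v))
outSum-upperBound (edge a _ ∷ is) (a≤1+d , _ , v) =
  ≤-trans (≤-reflexive (+-assoc a _ _))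
          (+-mono-≤ a≤1+d (outSum-upperBound is v))

white-noMisplaced : ∀ {d x n} is → outSum d is + x ≡ n → n ≤ d → misplacedStems white is ≡ 0
white-noMisplaced {d} {x} {n} is out+x≡n n≤d = m*[1+n]≤n⇒m≡0 (begin
  misplacedStems white is * suc d ≤⟨ outSum-lowerBound d is ⟩
  outSum d is                     ≤⟨ m≤m+n (outSum d is) x ⟩
  outSum d is + x                 ≡⟨ out+x≡n ⟩
  n                               ≤⟨ n≤d ⟩
  d                               ∎)
  where open ≤-Reasoning

black-noMisplaced : ∀ {d c} e is → ValidItems d c is →
  d * length is ≤ e + outSum d is → e + length is ≤ d → misplacedStems black is ≡ 0
black-noMisplaced e is v dl≤ e+l≤d = m*[1+n]≤n⇒m≡0
  (≤-trans (emptySlots-bound (misplacedStems black is) e dl≤ (outSum-upperBound is v)) e+l≤d)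

nonroot-noMisplaced : ∀ {d p} c is → ValidSub d c p (node is) → misplacedStems c is ≡ 0
nonroot-noMisplaced {d} {p} black is (deg≤d , out≡ , v) =
  black-noMisplaced 1 is v (d*l≤1+o out≡ (m∸n≤m (suc d) p)) deg≤d
  where
  d*l≤1+o : ∀ {o s l} → o + s ≡ d * suc l → s ≤ suc d → d * l ≤ 1 + o
  d*l≤1+o {o} {s} {l} o+s≡ s≤1+d = +-cancelˡ-≤ d (d * l) (1 + o) (begin
    d + d * l ≡⟨ sym (*-suc d l) ⟩
    d * suc l ≡⟨ sym o+s≡ ⟩
    o + s     ≤⟨ +-monoʳ-≤ o s≤1+d ⟩
    o + suc d ≡⟨ solve (o ∷ d ∷ []) ⟩
    d + (1 + o) ∎)
    where open ≤-Reasoning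
nonroot-noMisplaced white is (deg≤d , out≡ , _) = white-noMisplaced is out≡ deg≤d

flipC-involutive : ∀ c → flipC (flipC c) ≡ c
flipC-involutive black = refl
flipC-involutive white = refl

α-zero : ∀ d c → α d c 0 ≡ 0
α-zero d black = *-zeroʳ d
α-zero d white = refl

α-+ : ∀ d c m n → α d c (m + n) ≡ α d c m + α d c n
α-+ d black m n = *-distribˡ-+ d m n
α-+ d white m n = refl

α-flipC-1+α-1 : ∀ d c → α d (flipC c) 1 + α d c 1 ≡ suc d
α-flipC-1+α-1 d black = cong suc (*-identityʳ d)
α-flipC-1+α-1 d white = trans (cong (_+ 1) (*-identityʳ d)) (+-comm d 1)

+-interchange₃ : ∀ x y z u v w → (x + y + z) + (u + v + w) ≡ (x + u) + (y + v) + (z + w)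
+-interchange₃ x y z u v w =
  trans (interchange (x + y) z (u + v) w) (cong (_+ (z + w)) (interchange x y u v))

-- nClose − nOpen = α(#items) − outSum ∓ (d − 1)·misplaced (− at black, + at white vertices),
-- with the terms moved so that no subtraction occurs.
VertexBalance : ℕ → Colour → List Item → Set
VertexBalance d c is =
  nCloseI is + outSum d is + α d c (misplacedStems c is)
    ≡ nOpenI is + α d c (length is) + α d (flipC c) (misplacedStems c is)

-- Prepending an item containing a closing and n opening stems, with out-value o and
-- contributing m misplaced stems.
balance-step : ∀ d c a o m n is →
  a + o + α d c m ≡ n + α d c 1 + α d (flipC c) m → VertexBalance d c is →
  (a + nCloseI is) + (o + outSum d is) + α d c (m + misplacedStems c is)
    ≡ (n + nOpenI is) + α d c (suc (length is)) + α d (flipC c) (m + misplacedStems c is)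
balance-step d c a o m n is item rest = begin
  (a + A) + (o + O) + w (m + M)          ≡⟨ cong (_+_ ((a + A) + (o + O))) (α-+ d c m M) ⟩
  (a + A) + (o + O) + (w m + w M)        ≡⟨ sym (+-interchange₃ a o (w m) A O (w M)) ⟩
  (a + o + w m) + (A + O + w M)          ≡⟨ cong₂ _+_ item rest ⟩
  (n + w 1 + w′ m) + (N + w L + w′ M)    ≡⟨ +-interchange₃ n (w 1) (w′ m) N (w L) (w′ M) ⟩
  (n + N) + (w 1 + w L) + (w′ m + w′ M)
    ≡⟨ cong₂ (λ x y → (n + N) + x + y) (sym (α-+ d c 1 L)) (sym (α-+ d c′ m M)) ⟩
  (n + N) + w (suc L) + w′ (m + M)       ∎
  where
  open ≡-Reasoning
  c′ = flipC c
  w w′ : ℕ → ℕ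
  w  = α d c
  w′ = α d c′
  A = nCloseI is
  O = outSum d is
  M = misplacedStems c is
  N = nOpenI is
  L = length is

balance-without-misplaced : ∀ {d} c is → misplacedStems c is ≡ 0 → VertexBalance d c is →
  nCloseI is + outSum d is ≡ nOpenI is + α d c (length is)
balance-without-misplaced {d} c is none bal = begin
  A + O                       ≡⟨ sym (+-identityʳ _) ⟩
  A + O + 0                   ≡⟨ cong (_+_ _) (sym (vanishes c)) ⟩
  A + O + α d c M             ≡⟨ bal ⟩
  N + α d c L + α d c′ M      ≡⟨ cong (_+_ _) (vanishes c′) ⟩
  N + α d c L + 0             ≡⟨ +-identityʳ _ ⟩
  N + α d c L                 ∎
  where
  open ≡-Reasoning
  c′ = flipC c
  A = nCloseI is
  O = outSum d is
  M = misplacedStems c is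
  N = nOpenI is
  L = length is
  vanishes : ∀ c₀ → α d c₀ M ≡ 0
  vanishes c₀ = trans (cong (α d c₀) none) (α-zero d c₀)

opening-at-black : ∀ d → suc d + d * 0 ≡ 1 + d * 1 + 0
opening-at-black d = solve (d ∷ [])

closing-at-black : ∀ d → 1 + d * 1 ≡ d * 1 + 1
closing-at-black d = solve (d ∷ [])

opening-at-white : ∀ d → suc d + 1 ≡ 1 + 1 + d * 1
opening-at-white d = solve (d ∷ [])

closing-at-white : ∀ d → 1 ≡ 1 + d * 0
closing-at-white d = solve (d ∷ [])

mutual
  vertexBalance : ∀ {d} c is → ValidItems d c is → VertexBalance d c is
  vertexBalance {d} c [] _ =
    sym (trans (cong (_+_ (α d c 0)) (α-zero d (flipC c))) (+-identityʳ (α d c 0)))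
  vertexBalance {d} black (opening ∷ is) v =
    balance-step d black 0 (suc d) 0 1 is (opening-at-black d) (vertexBalance black is v)
  vertexBalance {d} black (closing ∷ is) v =
    balance-step d black 1 0 1 0 is (closing-at-black d) (vertexBalance black is v)
  vertexBalance {d} white (opening ∷ is) v =
    balance-step d white 0 (suc d) 1 1 is (opening-at-white d) (vertexBalance white is v)
  vertexBalance {d} white (closing ∷ is) v =
    balance-step d white 1 0 0 0 is (closing-at-white d) (vertexBalance white is v)
  vertexBalance {d} c (edge a (node ks) ∷ is) (a≤1+d , valid , v) =
    balance-step d c (nCloseI ks) a 0 (nOpenI ks) is
      (cong₂ _+_ child (trans (α-zero d c) (sym (α-zero d (flipC c)))))
      (vertexBalance c is v)
    where
    child : nCloseI ks + a ≡ nOpenI ks + α d c 1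
    child = subst (λ c′ → nCloseI ks + a ≡ nOpenI ks + α d c′ 1) (flipC-involutive c)
                  (subtreeBalance (flipC c) ks a≤1+d valid)

  subtreeBalance : ∀ {d p} c is → p ≤ suc d → ValidSub d c p (node is) →
    nCloseI is + p ≡ nOpenI is + α d (flipC c) 1
  subtreeBalance {d} {p} c is p≤1+d valid@(_ , out≡ , v) =
    +-cancelʳ-≡ (w (suc L)) (A + p) (N + w′ 1) (begin
      (A + p) + w (suc L)          ≡⟨ cong (_+_ (A + p)) (sym out≡) ⟩
      (A + p) + (O + (suc d ∸ p))  ≡⟨ interchange A p O (suc d ∸ p) ⟩
      (A + O) + (p + (suc d ∸ p))  ≡⟨ cong₂ _+_ bal (m+[n∸m]≡n p≤1+d) ⟩
      (N + w L) + suc d            ≡⟨ cong (_+_ (N + w L)) (sym (α-flipC-1+α-1 d c)) ⟩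
      (N + w L) + (w′ 1 + w 1)     ≡⟨ interchange N (w L) (w′ 1) (w 1) ⟩
      (N + w′ 1) + (w L + w 1)     ≡⟨ cong (_+_ (N + w′ 1)) (+-comm (w L) (w 1)) ⟩
      (N + w′ 1) + (w 1 + w L)     ≡⟨ cong (_+_ (N + w′ 1)) (sym (α-+ d c 1 L)) ⟩
      (N + w′ 1) + w (suc L)       ∎)
    where
    open ≡-Reasoning
    w w′ : ℕ → ℕ
    w  = α d c
    w′ = α d (flipC c)
    A = nCloseI is
    O = outSum d is
    N = nOpenI is
    L = length is
    bal : A + O ≡ N + w L
    bal = balance-without-misplaced c is (nonroot-noMisplaced {p = p} c is valid) (vertexBalance c is v)

i-j≡l⇒i≡l+j : ∀ i j {l : ℤ} → i -ᶻ j ≡ l → i ≡ l +ᶻ j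
i-j≡l⇒i≡l+j i j refl = ℤ-Solver.solve (i ∷ j ∷ [])

i-j≡-l⇒j≡i+l : ∀ i j {l : ℤ} → i -ᶻ j ≡ - l → j ≡ i +ᶻ l
i-j≡-l⇒j≡i+l i j {l} eq = begin
  j              ≡⟨ ℤ-Solver.solve (i ∷ j ∷ []) ⟩
  i +ᶻ - (i -ᶻ j) ≡⟨ cong (λ x → i +ᶻ - x) eq ⟩
  i +ᶻ - - l     ≡⟨ cong (i +ᶻ_) (ℤ.neg-involutive l) ⟩
  i +ᶻ l         ∎
  where open ≡-Reasoning

charge≡+⇒ : ∀ is {k} → charge (node is) ≡ + k → nCloseI is ≡ k + nOpenI is
charge≡+⇒ is {k} eq = ℤ.+-injective
  (trans (i-j≡l⇒i≡l+j (+ nCloseI is) (+ nOpenI is) eq) (sym (ℤ.pos-+ k (nOpenI is))))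

charge≡-⇒ : ∀ is {k} → charge (node is) ≡ - + k → nOpenI is ≡ nCloseI is + k
charge≡-⇒ is {k} eq = ℤ.+-injective
  (trans (i-j≡-l⇒j≡i+l (+ nCloseI is) (+ nOpenI is) eq) (sym (ℤ.pos-+ (nCloseI is) k)))

misplaced-or-trivial : ∀ c is → length is ≤ 1 → misplacedStems c is ≡ 0 ⊎ Trivial c (node is)
misplaced-or-trivial c     []                _ = inj₁ refl
misplaced-or-trivial c     (edge _ _ ∷ [])   _ = inj₁ refl
misplaced-or-trivial black (opening ∷ [])    _ = inj₁ refl
misplaced-or-trivial black (closing ∷ [])    _ = inj₂ (inj₁ (refl , refl))
misplaced-or-trivial white (opening ∷ [])    _ = inj₂ (inj₂ (refl , refl))
misplaced-or-trivial white (closing ∷ [])    _ = inj₁ refl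
misplaced-or-trivial c     (_ ∷ _ ∷ _) (s≤s ())

root-noMisplaced : ∀ {d} c is → length is ≤ d → ¬ Trivial c (node is) →
  d * misplacedStems c is ≡ misplacedStems c is → misplacedStems c is ≡ 0
root-noMisplaced {d} c is deg≤d nontrivial fixed with m*n≡n⇒n≡0⊎m≡1 d (misplacedStems c is) fixed
... | inj₁ none = none
... | inj₂ refl = [ id , ⊥-elim ∘ nontrivial ]′ (misplaced-or-trivial c is deg≤d)

minusBlackRoot-fixedPoint : ∀ {d k} is → ValidItems d black is → outSum d is + k ≡ d * length is →
  nCloseI is ≡ k + nOpenI is → d * misplacedStems black is ≡ misplacedStems black is
minusBlackRoot-fixedPoint {d} {k} is v out≡ charge≡ = +-cancelˡ-≡ (k + N + O) (d * M) M (begin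
  k + N + O + d * M ≡⟨ cong (λ x → x + O + d * M) (sym charge≡) ⟩
  A + O + d * M     ≡⟨ vertexBalance black is v ⟩
  N + d * L + M     ≡⟨ cong (λ x → N + x + M) (sym out≡) ⟩
  N + (O + k) + M   ≡⟨ cong (_+ M) (x∙yz≈zx∙y N O k) ⟩
  k + N + O + M     ∎)
  where
  open ≡-Reasoning
  A = nCloseI is
  O = outSum d is
  M = misplacedStems black is
  N = nOpenI is
  L = length is

plusWhiteRoot-fixedPoint : ∀ {d k} is → ValidItems d white is → outSum d is ≡ length is + k →
  nOpenI is ≡ nCloseI is + k → d * misplacedStems white is ≡ misplacedStems white is
plusWhiteRoot-fixedPoint {d} {k} is v out≡ charge≡ = sym (+-cancelˡ-≡ (A + k + L) M (d * M) (begin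
  A + k + L + M     ≡⟨ cong (_+ M) (sym (x∙yz≈xz∙y A L k)) ⟩
  A + (L + k) + M   ≡⟨ cong (λ x → A + x + M) (sym out≡) ⟩
  A + O + M         ≡⟨ vertexBalance white is v ⟩
  N + L + d * M     ≡⟨ cong (λ x → x + L + d * M) charge≡ ⟩
  A + k + L + d * M ∎))
  where
  open ≡-Reasoning
  A = nCloseI is
  O = outSum d is
  M = misplacedStems white is
  N = nOpenI is
  L = length is

rootMinus-noMisplaced : ∀ {d k} c is → ValidRootMinus d k c (node is) → ¬ Trivial c (node is) →
  charge (node is) ≡ + k → misplacedStems c is ≡ 0
rootMinus-noMisplaced black is (deg≤d , out≡ , v) nontrivial ch =
  root-noMisplaced black is deg≤d nontrivial (minusBlackRoot-fixedPoint is v out≡ (charge≡+⇒ is ch))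
rootMinus-noMisplaced white is (deg≤d , out≡ , _) _ _ = white-noMisplaced is out≡ deg≤d

rootPlus-noMisplaced : ∀ {d k} c is → ValidRootPlus d k c (node is) → ¬ Trivial c (node is) →
  charge (node is) ≡ - + k → misplacedStems c is ≡ 0
rootPlus-noMisplaced {d} {k} black is (deg≤d , out≡ , v) _ _ =
  black-noMisplaced 0 is v (≤-trans (m≤m+n (d * length is) k) (≤-reflexive (sym out≡))) deg≤d
rootPlus-noMisplaced white is (deg≤d , out≡ , v) nontrivial ch =
  root-noMisplaced white is deg≤d nontrivial (plusWhiteRoot-fixedPoint is v out≡ (charge≡-⇒ is ch))

nth-edge-valid : ∀ {d c} is i {a s} → ValidItems d c is → nth is i ≡ just (edge a s) →
  ValidSub d (flipC c) a s
nth-edge-valid (opening ∷ is)  (suc i) v       eq   = nth-edge-valid is i v eq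
nth-edge-valid (closing ∷ is)  (suc i) v       eq   = nth-edge-valid is i v eq
nth-edge-valid (edge _ _ ∷ _)  zero    (_ , valid , _) refl = valid
nth-edge-valid (edge _ _ ∷ is) (suc i) (_ , _ , v) eq = nth-edge-valid is i v eq

NoMisplacedStems : Colour → Tree → Set
NoMisplacedStems c t = ∀ u is → sub t u ≡ just (node is) → misplacedStems (colourAt c u) is ≡ 0

noMisplacedStems-fromRoot : ∀ {d} c is → misplacedStems c is ≡ 0 → ValidItems d c is →
  NoMisplacedStems c (node is)
noMisplacedStems-fromRoot c is none v []      js refl = none
noMisplacedStems-fromRoot c is none v (i ∷ u) js eq with nth is i in child
... | just (edge a (node ks)) =
  noMisplacedStems-fromRoot (flipC c) ks (nonroot-noMisplaced {p = a} (flipC c) ks valid) items u js eq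
  where
  valid = nth-edge-valid is i v child
  items = proj₂ (proj₂ valid)

closing∉ : ∀ {is} → misplacedStems black is ≡ 0 → ¬ closing ∈ is
closing∉ {closing ∷ _}   ()   _
closing∉ {opening ∷ _}   none (there m) = closing∉ none m
closing∉ {edge _ _ ∷ _}  none (there m) = closing∉ none m

opening∉ : ∀ {is} → misplacedStems white is ≡ 0 → ¬ opening ∈ is
opening∉ {opening ∷ _}   ()   _
opening∉ {closing ∷ _}   none (there m) = opening∉ none m
opening∉ {edge _ _ ∷ _}  none (there m) = opening∉ none m

noMisplaced⇒wellPlaced : ∀ c t → NoMisplacedStems c t → StemsWellPlaced c t
noMisplaced⇒wellPlaced c t none u is eq with colourAt c u | none u is eq
... | black | ok = (λ _ → refl) , (⊥-elim ∘ closing∉ ok)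
... | white | ok = (⊥-elim ∘ opening∉ ok) , (λ _ → refl)

lemma2p20 : (d k : ℕ) → 1 ≤ k → k ≤ d →
    ((c : Colour) (t : Tree) → IsAlphaMinusTree d k c t → charge t ≡ + k → StemsWellPlaced c t)
    × ((c : Colour) (t : Tree) → IsAlphaPlusTree d k c t → charge t ≡ - (+ k) → StemsWellPlaced c t)
lemma2p20 d k _ _ = minus , plus
  where
  minus : (c : Colour) (t : Tree) → IsAlphaMinusTree d k c t → charge t ≡ + k → StemsWellPlaced c t
  minus c (node is) (root@(_ , _ , v) , _ , nontrivial) ch = noMisplaced⇒wellPlaced c (node is)
    (noMisplacedStems-fromRoot c is (rootMinus-noMisplaced c is root nontrivial ch) v)
  plus : (c : Colour) (t : Tree) → IsAlphaPlusTree d k c t → charge t ≡ - (+ k) → StemsWellPlaced c t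
  plus c (node is) (root@(_ , _ , v) , _ , nontrivial) ch = noMisplaced⇒wellPlaced c (node is)
    (noMisplacedStems-fromRoot c is (rootPlus-noMisplaced c is root nontrivial ch) v)
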